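{- Let $G$ be an $n$-vertex graph with $m$ edges and let $k=p^r$ be a power of a prime. If $\chi_{\pm}(G)\le k$ and $m\le(k-1)n$, then $$P_{\pm}(G,k)\ge k^{\,n-\frac{m}{k-1}}.$$
   Context: A signed graph $(G,\epsilon)$ is a graph $G$ with a map $\epsilon:E(G)\to\{ -1,1\}$. The color sets are $M_{2t+1}=\{0,\pm1,\pm2,\dots,\pm t\}$ and $M_{2t}=\{\pm1,\pm2,\dots,\pm t\}$. A $k$-coloring of $(G,\epsilon)$ is a map $\kappa:V(G)\to M_k$ such that $\kappa(v)\ne\epsilon(e)\kappa(u)$ for every edge $e=uv$. $P((G,\epsilon),k)$ is the number of $k$-colorings of $(G,\epsilon)$, and $\chi(G,\epsilon)$ is the least $k$ for which a $k$-coloring exists. The signed chromatic number $\chi_\pm(G)$ is the least $k$ such that $(G,\epsilon)$ is $k$-colorable for every choice of $\epsilon$, and the signed chromatic function $P_\pm(G,k)$ is the minimum of $P((G,\epsilon),k)$ over all choices of $\epsilon$. -}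

module Defs where

open import Data.Nat as ℕ using (ℕ; zero; suc; ⌊_/2⌋; _≤_; _⊓_)
open import Data.Integer as ℤ using (ℤ; +_; -_; +[1+_])
open import Data.Integer.Properties as ℤP using ()
open import Data.Fin using (Fin)
open import Data.Fin.Properties using (all?)
open import Data.Vec using (Vec; []; _∷_; lookup)
open import Data.List using (List; []; _∷_; _++_; map; concatMap; length; filter; foldr)
open import Data.Product using (_×_; _,_; proj₁; proj₂; ∃)
open import Data.Sign using (Sign)
open import Data.Sum using (_⊎_)
open import Relation.Binary.PropositionalEquality using (_≡_; _≢_)
open import Relation.Nullary using (Dec; ¬?)
open import Relation.Nullary.Negation using (¬_)

record Graph (n : ℕ) : Set where
  field
    m        : ℕ
    edge     : Fin m → Fin n × Fin n
    loopless : ∀ i → proj₁ (edge i) ≢ proj₂ (edge i)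
    simple   : ∀ i j → i ≢ j →
               ¬ ((proj₁ (edge i) ≡ proj₁ (edge j) × proj₂ (edge i) ≡ proj₂ (edge j))
                ⊎ (proj₁ (edge i) ≡ proj₂ (edge j) × proj₂ (edge i) ≡ proj₁ (edge j)))

open Graph public

Signature : ∀ {n} → Graph n → Set
Signature G = Fin (m G) → Sign

applySign : Sign → ℤ → ℤ
applySign Sign.+ x = x
applySign Sign.- x = - x

-- Color sets: M_{2t+1} = {0,±1,…,±t}, M_{2t} = {±1,…,±t}
M : ℕ → List ℤ
M zero = []
M (suc zero) = + 0 ∷ []
M (suc (suc k)) = M k ++ (+[1+ ⌊ k /2⌋ ] ∷ - +[1+ ⌊ k /2⌋ ] ∷ [])

allMaps : ∀ {A : Set} → List A → (n : ℕ) → List (Vec A n)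
allMaps xs zero = [] ∷ []
allMaps xs (suc n) = concatMap (λ x → map (x ∷_) (allMaps xs n)) xs

IsColoring : ∀ {n} (G : Graph n) → Signature G → Vec ℤ n → Set
IsColoring G ε κ = ∀ i → lookup κ (proj₂ (edge G i)) ≢ applySign (ε i) (lookup κ (proj₁ (edge G i)))

isColoring? : ∀ {n} (G : Graph n) (ε : Signature G) (κ : Vec ℤ n) → Dec (IsColoring G ε κ)
isColoring? G ε κ = all? (λ i → ¬? (lookup κ (proj₂ (edge G i)) ℤP.≟ applySign (ε i) (lookup κ (proj₁ (edge G i)))))

P : ∀ {n} (G : Graph n) → Signature G → ℕ → ℕ
P {n} G ε k = length (filter (isColoring? G ε) (allMaps (M k) n))

allSignatures : ∀ {n} (G : Graph n) → List (Signature G)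
allSignatures G = map (λ v → lookup v) (allMaps (Sign.+ ∷ Sign.- ∷ []) (m G))

minimum : List ℕ → ℕ
minimum [] = 0
minimum (x ∷ xs) = foldr _⊓_ x xs

P± : ∀ {n} (G : Graph n) → ℕ → ℕ
P± G k = minimum (map (λ ε → P G ε k) (allSignatures G))

χ≤ : ∀ {n} (G : Graph n) → Signature G → ℕ → Set
χ≤ G ε k = ∃ λ k' → k' ≤ k × 0 ℕ.< P G ε k'

χ±≤ : ∀ {n} → Graph n → ℕ → Set
χ±≤ G k = ∀ (ε : Signature G) → χ≤ G ε k

module Submission where

-- A colouring of (G, ε) with colours in M k is a point of the grid (M k) ^ n where the integer
-- polynomial ∏_{e = uv} (x_v − ε(e) x_u), of degree m, does not vanish; as M k consists of k
-- distinct integers, P((G,ε),k) counts the non-zeros of this polynomial on the grid.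
-- An Alon–Füredi type count bounds the number N > 0 of non-zeros on S ^ n, |S| = k, of a
-- polynomial of degree ≤ d by N ^ (k − 1) ≥ k ^ ((k − 1) n − d). Expand in the first variable
-- and take the largest t whose coefficient g_t (of degree ≤ d − t) does not vanish on the grid:
-- wherever g_t ≠ 0 what remains is a univariate polynomial of degree t, with at least k − t
-- non-zeros on S, and k ^ (k − 1 − t) ≤ (k − t) ^ (k − 1) closes the induction on n.
-- χ_±(G) ≤ k makes every signature colourable, so N > 0, and P_± is attained at a signature.

open import Defs
open import Data.Nat as ℕ using (ℕ; zero; suc; z≤n; s≤s; s≤s⁻¹; _≤_; _<_; _≤?_; _<?_; _⊓_; ⌊_/2⌋)
import Data.Nat.Properties as ℕₚ
open import Data.Integer as ℤ using (ℤ; 0ℤ; 1ℤ; +[1+_]; -[1+_]; ∣_∣)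
import Data.Integer.Properties as ℤₚ
open import Data.Fin using (Fin)
import Data.Fin as Fin
open import Data.List using (List; []; _∷_; _++_; length; filter; map; concatMap; foldr)
import Data.List.Properties as Listₚ
open import Data.List.Membership.Propositional using (_∈_; _∉_)
open import Data.List.Membership.Propositional.Properties
  using (∈-map⁺; ∈-map⁻; ∈-concat⁺′; ∈-concat⁻′; ∈-++⁺ˡ; ∈-++⁺ʳ; ∈-++⁻; ∈-filter⁻)
open import Data.List.Membership.DecPropositional ℤₚ._≟_ using (_∈?_)
open import Data.List.Relation.Unary.Any using (here; there)
open import Data.List.Relation.Unary.All as Allₗ using ([]; _∷_)
open import Data.List.Relation.Unary.AllPairs using (AllPairs; []; _∷_)
import Data.List.Relation.Unary.AllPairs.Properties as AllPairsₚ
open import Data.Vec as Vec using (Vec; []; _∷_; lookup)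
import Data.Vec.Properties as Vecₚ
open import Data.Vec.Relation.Unary.All as Allᵥ using ([]; _∷_) renaming (All to AllV)
import Data.Vec.Relation.Unary.All.Properties as Allᵥₚ
open import Data.Vec.Membership.Propositional.Properties using (∈-lookup)
open import Data.Product using (Σ; ∃; ∃₂; _×_; _,_; proj₁; proj₂)
open import Data.Sum using (_⊎_; inj₁; inj₂; [_,_]′)
open import Data.Empty using (⊥-elim)
open import Data.Sign using (Sign)
open import Function using (_∘_)
open import Relation.Nullary using (¬_; Dec; yes; no)
open import Relation.Unary using (Decidable)
open import Relation.Binary.PropositionalEquality

module FiniteSums where
  open import Data.Nat using (_+_; _*_)
  open import Algebra.Properties.CommutativeSemigroup ℕₚ.+-commutativeSemigroup using (interchange)

  ∑ : {A : Set} → List A → (A → ℕ) → ℕ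
  ∑ []       w = 0
  ∑ (a ∷ as) w = w a + ∑ as w

  module _ {A : Set} where

    ∑-cong : ∀ (L : List A) {w w′} → (∀ {a} → a ∈ L → w a ≡ w′ a) → ∑ L w ≡ ∑ L w′
    ∑-cong []      eq = refl
    ∑-cong (a ∷ L) eq = cong₂ _+_ (eq (here refl)) (∑-cong L (eq ∘ there))

    ∑-mono : ∀ (L : List A) {w w′} → (∀ {a} → a ∈ L → w a ≤ w′ a) → ∑ L w ≤ ∑ L w′
    ∑-mono []      le = z≤n
    ∑-mono (a ∷ L) le = ℕₚ.+-mono-≤ (le (here refl)) (∑-mono L (le ∘ there))

    ∑-++ : ∀ (L L′ : List A) w → ∑ (L ++ L′) w ≡ ∑ L w + ∑ L′ w
    ∑-++ []      L′ w = refl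
    ∑-++ (a ∷ L) L′ w = trans (cong (w a +_) (∑-++ L L′ w)) (sym (ℕₚ.+-assoc (w a) _ _))

    ∑-+ : ∀ (L : List A) u v → ∑ L (λ a → u a + v a) ≡ ∑ L u + ∑ L v
    ∑-+ []      u v = refl
    ∑-+ (a ∷ L) u v = trans (cong (u a + v a +_) (∑-+ L u v)) (interchange (u a) (v a) _ _)

    ∑-*ˡ : ∀ (L : List A) c w → ∑ L (λ a → c * w a) ≡ c * ∑ L w
    ∑-*ˡ []      c w = sym (ℕₚ.*-zeroʳ c)
    ∑-*ˡ (a ∷ L) c w = trans (cong (c * w a +_) (∑-*ˡ L c w)) (sym (ℕₚ.*-distribˡ-+ c (w a) _))

    ∑≡0⇒≡0 : ∀ (L : List A) {w} → ∑ L w ≡ 0 → ∀ {a} → a ∈ L → w a ≡ 0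
    ∑≡0⇒≡0 (b ∷ L) {w} eq (here refl) = ℕₚ.m+n≡0⇒m≡0 (w b) eq
    ∑≡0⇒≡0 (b ∷ L) {w} eq (there p)   = ∑≡0⇒≡0 L (ℕₚ.m+n≡0⇒n≡0 (w b) eq) p

    ∑-pos : ∀ (L : List A) {w a} → a ∈ L → 0 < w a → 0 < ∑ L w
    ∑-pos (b ∷ L) {w} (here refl) pos = ℕₚ.<-≤-trans pos (ℕₚ.m≤m+n (w b) _)
    ∑-pos (b ∷ L) {w} (there p)   pos = ℕₚ.<-≤-trans (∑-pos L p pos) (ℕₚ.m≤n+m _ (w b))

  ∑-zero : {A : Set} (L : List A) → ∑ L (λ _ → 0) ≡ 0
  ∑-zero []      = refl
  ∑-zero (_ ∷ L) = ∑-zero L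

  ∑-map : {A B : Set} (f : A → B) (L : List A) (w : B → ℕ) → ∑ (map f L) w ≡ ∑ L (λ a → w (f a))
  ∑-map f []      w = refl
  ∑-map f (a ∷ L) w = cong (w (f a) +_) (∑-map f L w)

  ∑-concatMap : {A B : Set} (F : A → List B) (L : List A) (w : B → ℕ) →
                ∑ (concatMap F L) w ≡ ∑ L (λ a → ∑ (F a) w)
  ∑-concatMap F []      w = refl
  ∑-concatMap F (a ∷ L) w =
    trans (∑-++ (F a) (concatMap F L) w) (cong (∑ (F a) w +_) (∑-concatMap F L w))

  ∑-comm : {A B : Set} (L : List A) (L′ : List B) (w : A → B → ℕ) →
           ∑ L (λ a → ∑ L′ (w a)) ≡ ∑ L′ (λ b → ∑ L (λ a → w a b))
  ∑-comm []      L′ w = sym (∑-zero L′)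
  ∑-comm (a ∷ L) L′ w =
    trans (cong (∑ L′ (w a) +_) (∑-comm L L′ w)) (sym (∑-+ L′ (w a) (λ b → ∑ L (λ a → w a b))))

module Grid {A : Set} (S : List A) where
  open FiniteSums

  allMaps-sound : ∀ {n} {v : Vec A n} → v ∈ allMaps S n → AllV (_∈ S) v
  allMaps-sound {zero}  {[]} _ = []
  allMaps-sound {suc n} v∈ with ∈-concat⁻′ (map (λ x → map (x ∷_) (allMaps S n)) S) v∈
  ... | vs , v∈vs , vs∈ with ∈-map⁻ (λ x → map (x ∷_) (allMaps S n)) vs∈
  ... | x , x∈S , refl with ∈-map⁻ (x ∷_) v∈vs
  ... | xs , xs∈ , refl = x∈S ∷ allMaps-sound xs∈

  allMaps-complete : ∀ {n} {v : Vec A n} → AllV (_∈ S) v → v ∈ allMaps S n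
  allMaps-complete []           = here refl
  allMaps-complete (x∈S ∷ xs∈S) = ∈-concat⁺′ (∈-map⁺ (_ ∷_) (allMaps-complete xs∈S)) (∈-map⁺ (λ x → map (x ∷_) (allMaps S _)) x∈S)

  ∑-allMaps-suc : ∀ n w → ∑ (allMaps S (suc n)) w ≡ ∑ (allMaps S n) (λ xs → ∑ S (λ x → w (x ∷ xs)))
  ∑-allMaps-suc n w = begin
    ∑ (allMaps S (suc n)) w                              ≡⟨ ∑-concatMap (λ x → map (x ∷_) (allMaps S n)) S w ⟩
    ∑ S (λ x → ∑ (map (x ∷_) (allMaps S n)) w)           ≡⟨ ∑-cong S (λ {x} _ → ∑-map (x ∷_) (allMaps S n) w) ⟩
    ∑ S (λ x → ∑ (allMaps S n) (λ xs → w (x ∷ xs)))      ≡⟨ ∑-comm S (allMaps S n) (λ x xs → w (x ∷ xs)) ⟩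
    ∑ (allMaps S n) (λ xs → ∑ S (λ x → w (x ∷ xs)))      ∎
    where open ≡-Reasoning

Distinct : List ℤ → Set
Distinct = AllPairs _≢_

nonzero : ℤ → ℕ
nonzero (ℤ.+ zero) = 0
nonzero +[1+ _ ]  = 1
nonzero -[1+ _ ]  = 1

nonzero-≢0 : ∀ {z} → z ≢ 0ℤ → nonzero z ≡ 1
nonzero-≢0 {ℤ.+ zero} z≢0 = ⊥-elim (z≢0 refl)
nonzero-≢0 {+[1+ _ ]} _   = refl
nonzero-≢0 { -[1+ _ ]} _  = refl

nonzero-¬≢0 : ∀ {z} → ¬ z ≢ 0ℤ → nonzero z ≡ 0
nonzero-¬≢0 {ℤ.+ zero} _    = refl
nonzero-¬≢0 {+[1+ _ ]} ¬z≢0 = ⊥-elim (¬z≢0 λ ())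
nonzero-¬≢0 { -[1+ _ ]} ¬z≢0 = ⊥-elim (¬z≢0 λ ())

nonzero≡0⇒≡0 : ∀ z → nonzero z ≡ 0 → z ≡ 0ℤ
nonzero≡0⇒≡0 (ℤ.+ zero) _ = refl

nonzero-* : ∀ a b → a ≢ 0ℤ → nonzero (a ℤ.* b) ≡ nonzero b
nonzero-* a b a≢0 with b ℤₚ.≟ 0ℤ
... | yes refl = cong nonzero (ℤₚ.*-zeroʳ a)
... | no  b≢0  = trans (nonzero-≢0 ([ a≢0 , b≢0 ]′ ∘ ℤₚ.i*j≡0⇒i≡0∨j≡0 a)) (sym (nonzero-≢0 b≢0))

module Univariate where
  open import Data.Integer using (_+_; _*_; _-_; -_; _^_)
  open import Data.Integer.Solver using (module +-*-Solver)
  open +-*-Solver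
  open FiniteSums

  tail : (ℕ → ℤ) → ℕ → ℤ
  tail c j = c (suc j)

  eval : ℕ → (ℕ → ℤ) → ℤ → ℤ
  eval zero    c x = 0ℤ
  eval (suc e) c x = c 0 + x * eval e (tail c) x

  eval-cong : ∀ e {c c′} x → (∀ {j} → j < e → c j ≡ c′ j) → eval e c x ≡ eval e c′ x
  eval-cong zero    x eq = refl
  eval-cong (suc e) x eq = cong₂ (λ a b → a + x * b) (eq (s≤s z≤n)) (eval-cong e x (λ j<e → eq (s≤s j<e)))

  eval-vanishing : ∀ e {c} x → (∀ {j} → j < e → c j ≡ 0ℤ) → eval e c x ≡ 0ℤ
  eval-vanishing zero    x eq = refl
  eval-vanishing (suc e) {c} x eq = begin
    c 0 + x * eval e (tail c) x ≡⟨ cong₂ (λ a b → a + x * b) (eq (s≤s z≤n)) (eval-vanishing e x (λ j<e → eq (s≤s j<e))) ⟩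
    0ℤ + x * 0ℤ                  ≡⟨ solve 1 (λ x → con 0ℤ :+ x :* con 0ℤ := con 0ℤ) refl x ⟩
    0ℤ                           ∎
    where open ≡-Reasoning

  eval-+ : ∀ e a b x → eval e (λ j → a j + b j) x ≡ eval e a x + eval e b x
  eval-+ zero    a b x = refl
  eval-+ (suc e) a b x rewrite eval-+ e (tail a) (tail b) x =
    solve 5 (λ a₀ b₀ x p q → (a₀ :+ b₀) :+ x :* (p :+ q) := (a₀ :+ x :* p) :+ (b₀ :+ x :* q))
      refl (a 0) (b 0) x (eval e (tail a) x) (eval e (tail b) x)

  eval-*ˡ : ∀ e z a x → eval e (λ j → z * a j) x ≡ z * eval e a x
  eval-*ˡ zero    z a x = sym (ℤₚ.*-zeroʳ z)
  eval-*ˡ (suc e) z a x rewrite eval-*ˡ e z (tail a) x =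
    solve 4 (λ z a₀ x p → z :* a₀ :+ x :* (z :* p) := z :* (a₀ :+ x :* p)) refl z (a 0) x (eval e (tail a) x)

  eval-*ʳ : ∀ e z a x → eval e (λ j → a j * z) x ≡ eval e a x * z
  eval-*ʳ e z a x = begin
    eval e (λ j → a j * z) x ≡⟨ eval-cong e x (λ {j} _ → ℤₚ.*-comm (a j) z) ⟩
    eval e (λ j → z * a j) x ≡⟨ eval-*ˡ e z a x ⟩
    z * eval e a x           ≡⟨ ℤₚ.*-comm z _ ⟩
    eval e a x * z           ∎
    where open ≡-Reasoning

  eval-suc : ∀ e c x → eval (suc e) c x ≡ eval e c x + c e * x ^ e
  eval-suc zero    c x = solve 2 (λ c₀ x → c₀ :+ x :* con 0ℤ := con 0ℤ :+ c₀ :* con 1ℤ) refl (c 0) x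
  eval-suc (suc e) c x rewrite eval-suc e (tail c) x =
    solve 5 (λ c₀ x p cₑ xₑ → c₀ :+ x :* (p :+ cₑ :* xₑ) := (c₀ :+ x :* p) :+ cₑ :* (x :* xₑ))
      refl (c 0) x (eval e (tail c) x) (c (suc e)) (x ^ e)

  eval-shrink : ∀ e t c x → t < e → (∀ {j} → t < j → j < e → c j ≡ 0ℤ) → eval e c x ≡ eval (suc t) c x
  eval-shrink (suc e) t c x (s≤s t≤e) high with ℕₚ.m≤n⇒m<n∨m≡n t≤e
  ... | inj₂ refl = refl
  ... | inj₁ t<e = begin
    eval (suc e) c x         ≡⟨ eval-suc e c x ⟩
    eval e c x + c e * x ^ e ≡⟨ cong (λ w → eval e c x + w * x ^ e) (high t<e ℕₚ.≤-refl) ⟩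
    eval e c x + 0ℤ * x ^ e  ≡⟨ ℤₚ.+-identityʳ (eval e c x) ⟩
    eval e c x               ≡⟨ eval-shrink e t c x t<e (λ t<j j<e → high t<j (ℕₚ.m<n⇒m<1+n j<e)) ⟩
    eval (suc t) c x         ∎
    where open ≡-Reasoning

  nonroots : List ℤ → (ℤ → ℤ) → ℕ
  nonroots S p = ∑ S (λ x → nonzero (p x))

  quotient : ℕ → (ℕ → ℤ) → ℤ → ℕ → ℤ
  quotient zero    c s _       = 0ℤ
  quotient (suc e) c s zero    = eval (suc e) (tail c) s
  quotient (suc e) c s (suc j) = quotient e (tail c) s j

  eval-divide : ∀ e c s x → eval (suc e) c x ≡ eval (suc e) c s + (x - s) * eval e (quotient e c s) x
  eval-divide zero    c s x = solve 3 (λ c₀ x s → c₀ :+ x :* con 0ℤ := (c₀ :+ s :* con 0ℤ) :+ (x :- s) :* con 0ℤ) refl (c 0) x s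
  eval-divide (suc e) c s x rewrite eval-divide e (tail c) s x =
    solve 5 (λ c₀ x s a q → c₀ :+ x :* (a :+ (x :- s) :* q) := (c₀ :+ s :* a) :+ (x :- s) :* (a :+ x :* q))
      refl (c 0) x s (eval (suc e) (tail c) s) (eval e (quotient e (tail c) s) x)

  quotient-leading : ∀ e c s → quotient (suc e) c s e ≡ c (suc e)
  quotient-leading zero    c s = trans (cong (λ w → c 1 + w) (ℤₚ.*-zeroʳ s)) (ℤₚ.+-identityʳ (c 1))
  quotient-leading (suc e) c s = quotient-leading e (tail c) s

  factor-theorem : ∀ e c {s} x → eval (suc e) c s ≡ 0ℤ → eval (suc e) c x ≡ (x - s) * eval e (quotient e c s) x
  factor-theorem e c {s} x ps≡0 = begin
    eval (suc e) c x                                  ≡⟨ eval-divide e c s x ⟩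
    eval (suc e) c s + (x - s) * eval e (quotient e c s) x ≡⟨ cong (_+ (x - s) * eval e (quotient e c s) x) ps≡0 ⟩
    0ℤ + (x - s) * eval e (quotient e c s) x         ≡⟨ ℤₚ.+-identityˡ _ ⟩
    (x - s) * eval e (quotient e c s) x              ∎
    where open ≡-Reasoning

  eval-constant : ∀ c x → eval 1 c x ≡ c 0
  eval-constant c x = trans (cong (λ w → c 0 + w) (ℤₚ.*-zeroʳ x)) (ℤₚ.+-identityʳ (c 0))

  length≤nonroots+degree : ∀ {S} → Distinct S → ∀ t c → c t ≢ 0ℤ → length S ≤ nonroots S (eval (suc t) c) ℕ.+ t
  length≤nonroots+degree [] t c ct≢0 = z≤n
  length≤nonroots+degree {s ∷ S} (s∉S ∷ S-distinct) t c ct≢0 with eval (suc t) c s ℤₚ.≟ 0ℤ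
  ... | no ps≢0 rewrite nonzero-≢0 ps≢0 = s≤s (length≤nonroots+degree S-distinct t c ct≢0)
  length≤nonroots+degree {s ∷ S} _ zero c c0≢0 | yes ps≡0 =
    ⊥-elim (c0≢0 (trans (sym (eval-constant c s)) ps≡0))
  length≤nonroots+degree {s ∷ S} (s∉S ∷ S-distinct) (suc t) c ct≢0 | yes ps≡0 rewrite ps≡0 = begin
    suc (length S)                                   ≤⟨ s≤s (length≤nonroots+degree S-distinct t q qt≢0) ⟩
    suc (nonroots S (eval (suc t) q) ℕ.+ t)          ≡⟨ ℕₚ.+-suc _ t ⟨
    nonroots S (eval (suc t) q) ℕ.+ suc t            ≡⟨ cong (ℕ._+ suc t) same-nonroots ⟨
    nonroots S (eval (suc (suc t)) c) ℕ.+ suc t      ∎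
    where
    open ℕₚ.≤-Reasoning
    q = quotient (suc t) c s
    qt≢0 : q t ≢ 0ℤ
    qt≢0 = ct≢0 ∘ trans (sym (quotient-leading t c s))
    same-nonroots : nonroots S (eval (suc (suc t)) c) ≡ nonroots S (eval (suc t) q)
    same-nonroots = ∑-cong S λ {x} x∈S → trans
      (cong nonzero (factor-theorem (suc t) c x ps≡0))
      (nonzero-* (x - s) _ (λ x-s≡0 → Allₗ.lookup s∉S x∈S (sym (ℤₚ.i-j≡0⇒i≡j x s x-s≡0))))

  shift : (ℕ → ℤ) → ℕ → ℤ
  shift c zero    = 0ℤ
  shift c (suc j) = c j

  eval-shift : ∀ e c x → eval (suc e) (shift c) x ≡ x * eval e c x
  eval-shift e c x = ℤₚ.+-identityˡ _

  truncate : ℕ → (ℕ → ℤ) → ℕ → ℤ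
  truncate zero    c j       = 0ℤ
  truncate (suc e) c zero    = c 0
  truncate (suc e) c (suc j) = truncate e (tail c) j

  eval-shrink-top : ∀ e c x → eval (suc e) (truncate e c) x ≡ eval e c x
  eval-shrink-top e c x = begin
    eval (suc e) (truncate e c) x                      ≡⟨ eval-suc e (truncate e c) x ⟩
    eval e (truncate e c) x + truncate e c e * x ^ e   ≡⟨ cong₂ (λ a b → a + b * x ^ e) (eval-cong e x (below e c)) (top e c) ⟩
    eval e c x + 0ℤ * x ^ e                            ≡⟨ ℤₚ.+-identityʳ _ ⟩
    eval e c x                                         ∎
    where
    open ≡-Reasoning
    below : ∀ e c {j} → j < e → truncate e c j ≡ c j
    below (suc e) c {zero}  _         = refl
    below (suc e) c {suc j} (s≤s j<e) = below e (tail c) j<e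
    top : ∀ e c → truncate e c e ≡ 0ℤ
    top zero    c = refl
    top (suc e) c = top e (tail c)

  monomial : ℕ → ℕ → ℤ
  monomial zero    zero    = 1ℤ
  monomial zero    (suc j) = 0ℤ
  monomial (suc e) zero    = 0ℤ
  monomial (suc e) (suc j) = monomial e j

  eval-monomial : ∀ e x → eval (suc e) (monomial e) x ≡ x ^ e
  eval-monomial zero    x = eval-constant (monomial 0) x
  eval-monomial (suc e) x = trans (eval-shift (suc e) (monomial e) x) (cong (x *_) (eval-monomial e x))

  -- r is read off from x ^ e - ∏_{s ∈ S} (x - s), which vanishes on S.
  power-reduction : (S : List ℤ) → Σ (ℕ → ℤ) λ r → ∀ {x} → x ∈ S → x ^ length S ≡ eval (length S) r x
  power-reduction []      = (λ _ → 0ℤ) , λ ()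
  power-reduction (s ∷ S) = r , r-reduces
    where
    e  = length S
    r′ = proj₁ (power-reduction S)
    r : ℕ → ℤ
    r j = (shift r′ j + (- s) * truncate e r′ j) + s * monomial e j
    eval-r : ∀ x → eval (suc e) r x ≡ (x * eval e r′ x + (- s) * eval e r′ x) + s * x ^ e
    eval-r x = begin
      eval (suc e) r x
        ≡⟨ eval-+ (suc e) (λ j → shift r′ j + (- s) * truncate e r′ j) (λ j → s * monomial e j) x ⟩
      eval (suc e) (λ j → shift r′ j + (- s) * truncate e r′ j) x + eval (suc e) (λ j → s * monomial e j) x
        ≡⟨ cong₂ _+_ (eval-+ (suc e) (shift r′) (λ j → (- s) * truncate e r′ j) x) (eval-*ˡ (suc e) s (monomial e) x) ⟩
      (eval (suc e) (shift r′) x + eval (suc e) (λ j → (- s) * truncate e r′ j) x) + s * eval (suc e) (monomial e) x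
        ≡⟨ cong₂ (λ a b → (eval (suc e) (shift r′) x + a) + s * b)
                 (trans (eval-*ˡ (suc e) (- s) (truncate e r′) x) (cong ((- s) *_) (eval-shrink-top e r′ x)))
                 (eval-monomial e x) ⟩
      (eval (suc e) (shift r′) x + (- s) * eval e r′ x) + s * x ^ e
        ≡⟨ cong (λ a → (a + (- s) * eval e r′ x) + s * x ^ e) (eval-shift e r′ x) ⟩
      (x * eval e r′ x + (- s) * eval e r′ x) + s * x ^ e ∎
      where open ≡-Reasoning
    r-reduces : ∀ {x} → x ∈ s ∷ S → x ^ suc e ≡ eval (suc e) r x
    r-reduces {x} (here refl) rewrite eval-r x =
      solve 3 (λ x p xₑ → x :* xₑ := (x :* p :+ (:- x) :* p) :+ x :* xₑ) refl x (eval e r′ x) (x ^ e)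
    r-reduces {x} (there x∈S) rewrite eval-r x | proj₂ (power-reduction S) x∈S =
      solve 3 (λ x s p → x :* p := (x :* p :+ (:- s) :* p) :+ s :* p) refl x s (eval e r′ x)

  eval-*-linear : ∀ k₁ c r α λ₀ x → x ^ suc k₁ ≡ eval (suc k₁) r x →
    eval (suc k₁) c x * (α * x + λ₀) ≡ eval (suc k₁) (λ j → (c j * λ₀ + α * shift c j) + α * (r j * c k₁)) x
  eval-*-linear k₁ c r α λ₀ x reduces = begin
    eval k c x * (α * x + λ₀)
      ≡⟨ cong (_* (α * x + λ₀)) (eval-suc k₁ c x) ⟩
    (A + B * X) * (α * x + λ₀)
      ≡⟨ solve 6 (λ A B X α x λ₀ → (A :+ B :* X) :* (α :* x :+ λ₀) :=
                   ((A :+ B :* X) :* λ₀ :+ α :* (x :* A)) :+ α :* ((x :* X) :* B)) refl A B X α x λ₀ ⟩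
    ((A + B * X) * λ₀ + α * (x * A)) + α * ((x * X) * B)
      ≡⟨ cong₂ (λ u v → (u * λ₀ + α * v) + α * ((x * X) * B)) (eval-suc k₁ c x) (eval-shift k₁ c x) ⟨
    (eval k c x * λ₀ + α * eval k (shift c) x) + α * ((x * X) * B)
      ≡⟨ cong (λ w → (eval k c x * λ₀ + α * eval k (shift c) x) + α * (w * B)) reduces ⟩
    (eval k c x * λ₀ + α * eval k (shift c) x) + α * (eval k r x * B)
      ≡⟨ cong₂ (λ u v → (u + v) + α * (eval k r x * B)) (eval-*ʳ k λ₀ c x) (eval-*ˡ k α (shift c) x) ⟨
    (eval k (λ j → c j * λ₀) x + eval k (λ j → α * shift c j) x) + α * (eval k r x * B)
      ≡⟨ cong (λ w → (eval k (λ j → c j * λ₀) x + eval k (λ j → α * shift c j) x) + α * w) (eval-*ʳ k B r x) ⟨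
    (eval k (λ j → c j * λ₀) x + eval k (λ j → α * shift c j) x) + α * eval k (λ j → r j * B) x
      ≡⟨ cong₂ _+_ (sym (eval-+ k (λ j → c j * λ₀) (λ j → α * shift c j) x)) (sym (eval-*ˡ k α (λ j → r j * B) x)) ⟩
    eval k (λ j → c j * λ₀ + α * shift c j) x + eval k (λ j → α * (r j * B)) x
      ≡⟨ sym (eval-+ k (λ j → c j * λ₀ + α * shift c j) (λ j → α * (r j * B)) x) ⟩
    eval k (λ j → (c j * λ₀ + α * shift c j) + α * (r j * B)) x ∎
    where
    open ≡-Reasoning
    k = suc k₁
    A = eval k₁ c x
    B = c k₁
    X = x ^ k₁

module PowerBounds where
  open import Data.Nat using (_+_; _*_; _∸_; _^_)
  open import Data.Nat.Solver using (module +-*-Solver)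
  open +-*-Solver
  open ℕₚ using (*-monoʳ-≤; *-monoˡ-≤; *-assoc)

  [1+m]^n≤[1+n]*m^n : ∀ m n → n ≤ m → suc m ^ n ≤ suc n * m ^ n
  [1+m]^n≤[1+n]*m^n m zero    _   = ℕₚ.≤-refl
  [1+m]^n≤[1+n]*m^n m (suc n) n<m = begin
    suc m * suc m ^ n           ≤⟨ *-monoʳ-≤ (suc m) ([1+m]^n≤[1+n]*m^n m n (ℕₚ.<⇒≤ n<m)) ⟩
    suc m * (suc n * m ^ n)     ≡⟨ *-assoc (suc m) (suc n) (m ^ n) ⟨
    (suc m * suc n) * m ^ n     ≤⟨ *-monoˡ-≤ (m ^ n) (ℕₚ.+-mono-≤ n<m (ℕₚ.≤-reflexive (ℕₚ.*-comm m (suc n)))) ⟩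
    (suc (suc n) * m) * m ^ n   ≡⟨ *-assoc (suc (suc n)) m (m ^ n) ⟩
    suc (suc n) * (m * m ^ n)   ∎
    where open ℕₚ.≤-Reasoning

  [1+m+n]^m≤[1+m]^[m+n] : ∀ m n → suc (m + n) ^ m ≤ suc m ^ (m + n)
  [1+m+n]^m≤[1+m]^[m+n] m zero    rewrite ℕₚ.+-identityʳ m = ℕₚ.≤-refl
  [1+m+n]^m≤[1+m]^[m+n] m (suc n) rewrite ℕₚ.+-suc m n = begin
    suc (suc (m + n)) ^ m     ≤⟨ [1+m]^n≤[1+n]*m^n (suc (m + n)) m (ℕₚ.m≤n⇒m≤1+n (ℕₚ.m≤m+n m n)) ⟩
    suc m * suc (m + n) ^ m   ≤⟨ *-monoʳ-≤ (suc m) ([1+m+n]^m≤[1+m]^[m+n] m n) ⟩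
    suc m * suc m ^ (m + n)   ∎
    where open ℕₚ.≤-Reasoning

  [1+m]^[m∸n]≤[1+m∸n]^m : ∀ m n → n ≤ m → suc m ^ (m ∸ n) ≤ (suc m ∸ n) ^ m
  [1+m]^[m∸n]≤[1+m∸n]^m m n n≤m =
    subst₂ (λ a b → suc a ^ (m ∸ n) ≤ b ^ a) (ℕₚ.m∸n+n≡m n≤m) (sym (ℕₚ.+-∸-assoc 1 n≤m))
      ([1+m+n]^m≤[1+m]^[m+n] (m ∸ n) n)

  ^-distrib-* : ∀ a b e → (a * b) ^ e ≡ a ^ e * b ^ e
  ^-distrib-* a b zero    = refl
  ^-distrib-* a b (suc e) rewrite ^-distrib-* a b e =
    solve 4 (λ a b x y → (a :* b) :* (x :* y) := (a :* x) :* (b :* y)) refl a b (a ^ e) (b ^ e)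

  exponent-split : ∀ k₁ n d t → t ≤ d → t ≤ k₁ → k₁ * suc n ∸ d ≤ (k₁ ∸ t) + (k₁ * n ∸ (d ∸ t))
  exponent-split k₁ n d t t≤d t≤k₁ = ℕₚ.m≤n+o⇒m∸n≤o (k₁ * suc n) d (begin
    k₁ * suc n                                         ≡⟨ ℕₚ.*-suc k₁ n ⟩
    k₁ + k₁ * n                                        ≤⟨ ℕₚ.+-monoʳ-≤ k₁ (ℕₚ.m≤n+m∸n (k₁ * n) (d ∸ t)) ⟩
    k₁ + ((d ∸ t) + X)                                 ≡⟨ cong (_+ ((d ∸ t) + X)) (ℕₚ.m+[n∸m]≡n t≤k₁) ⟨
    (t + (k₁ ∸ t)) + ((d ∸ t) + X)                     ≡⟨ solve 4 (λ t a b x → (t :+ a) :+ (b :+ x) := (t :+ b) :+ (a :+ x)) refl t (k₁ ∸ t) (d ∸ t) X ⟩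
    (t + (d ∸ t)) + ((k₁ ∸ t) + X)                     ≡⟨ cong (_+ ((k₁ ∸ t) + X)) (ℕₚ.m+[n∸m]≡n t≤d) ⟩
    d + ((k₁ ∸ t) + X)                                 ∎)
    where
    open ℕₚ.≤-Reasoning
    X = k₁ * n ∸ (d ∸ t)

  alon-füredi-step : ∀ k₁ n d t M N → t ≤ d → t ≤ k₁ →
    suc k₁ ^ (k₁ * n ∸ (d ∸ t)) ≤ M ^ k₁ → (suc k₁ ∸ t) * M ≤ N → suc k₁ ^ (k₁ * suc n ∸ d) ≤ N ^ k₁
  alon-füredi-step k₁ n d t M N t≤d t≤k₁ IH M≤N = begin
    suc k₁ ^ (k₁ * suc n ∸ d)                        ≤⟨ ℕₚ.^-monoʳ-≤ (suc k₁) (exponent-split k₁ n d t t≤d t≤k₁) ⟩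
    suc k₁ ^ ((k₁ ∸ t) + (k₁ * n ∸ (d ∸ t)))         ≡⟨ ℕₚ.^-distribˡ-+-* (suc k₁) (k₁ ∸ t) _ ⟩
    suc k₁ ^ (k₁ ∸ t) * suc k₁ ^ (k₁ * n ∸ (d ∸ t))  ≤⟨ ℕₚ.*-mono-≤ ([1+m]^[m∸n]≤[1+m∸n]^m k₁ t t≤k₁) IH ⟩
    (suc k₁ ∸ t) ^ k₁ * M ^ k₁                       ≡⟨ ^-distrib-* (suc k₁ ∸ t) M k₁ ⟨
    ((suc k₁ ∸ t) * M) ^ k₁                          ≤⟨ ℕₚ.^-monoˡ-≤ k₁ M≤N ⟩
    N ^ k₁                                           ∎
    where open ℕₚ.≤-Reasoning

largest? : {P : ℕ → Set} → (∀ j → Dec (P j)) → ∀ e →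
  (∀ {j} → j < e → ¬ P j) ⊎ ∃ λ t → t < e × P t × (∀ {j} → t < j → j < e → ¬ P j)
largest? P? zero = inj₁ λ ()
largest? P? (suc e) with P? e | largest? P? e
... | yes Pe | _ = inj₂ (e , ℕₚ.n<1+n e , Pe , λ e<j j<1+e → ⊥-elim (ℕₚ.<-irrefl refl (ℕₚ.<-≤-trans e<j (s≤s⁻¹ j<1+e))))
... | no ¬Pe | inj₁ none = inj₁ λ j<1+e → [ none , (λ { refl → ¬Pe }) ]′ (ℕₚ.m<1+n⇒m<n∨m≡n j<1+e)
... | no ¬Pe | inj₂ (t , t<e , Pt , above) = inj₂ (t , ℕₚ.m<n⇒m<1+n t<e , Pt , above′)
  where
  above′ : ∀ {j} → t < j → j < suc e → ¬ _
  above′ t<j j<1+e with ℕₚ.m<1+n⇒m<n∨m≡n j<1+e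
  ... | inj₁ j<e = above t<j j<e
  ... | inj₂ refl = ¬Pe

data Affine : (n : ℕ) → (Vec ℤ n → ℤ) → Set where
  constant : ∀ {ℓ} → Affine 0 ℓ
  expand   : ∀ {n ℓ} α ℓ′ → Affine n ℓ′ → (∀ x xs → ℓ (x ∷ xs) ≡ α ℤ.* x ℤ.+ ℓ′ xs) → Affine (suc n) ℓ

∏ : (m : ℕ) → (Fin m → ℤ) → ℤ
∏ zero    h = 1ℤ
∏ (suc m) h = h Fin.zero ℤ.* ∏ m (λ i → h (Fin.suc i))

module AlonFüredi (k₁ : ℕ) (S : List ℤ) (S-distinct : Distinct S) (|S|≡k : length S ≡ suc k₁) where
  open import Data.Integer using (_+_; _*_)
  open import Data.Nat using (_∸_; _^_)
  open FiniteSums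
  open Grid S
  open Univariate
  open PowerBounds using (alon-füredi-step)

  k : ℕ
  k = suc k₁

  r : ℕ → ℤ
  r = proj₁ (power-reduction S)

  r-reduces : ∀ {x} → x ∈ S → x ℤ.^ k ≡ eval k r x
  r-reduces = subst (λ e → ∀ {x} → x ∈ S → x ℤ.^ e ≡ eval e r x) |S|≡k (proj₂ (power-reduction S))

  OnGrid : ∀ {n} → Vec ℤ n → Set
  OnGrid = AllV (_∈ S)

  Vanishes : ∀ {n} → (Vec ℤ n → ℤ) → Set
  Vanishes f = ∀ {v} → OnGrid v → f v ≡ 0ℤ

  -- On the grid S ^ n, f is given by a polynomial of total degree ≤ d: expanding in the
  -- first variable (after reducing x ^ k with r), f (x ∷ xs) = ∑_{j<k} g j xs · x ^ j
  -- where g j has degree ≤ d ∸ j, and vanishes on the grid when j > d.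
  data Degree≤ : (n d : ℕ) → (Vec ℤ n → ℤ) → Set where
    constant : ∀ {d f} → Degree≤ 0 d f
    expand   : ∀ {n d f} (g : ℕ → Vec ℤ n → ℤ) →
               (∀ {j} → j < k → Degree≤ n (d ∸ j) (g j)) →
               (∀ {j} → j < k → d < j → Vanishes (g j)) →
               (∀ {x xs} → x ∈ S → OnGrid xs → f (x ∷ xs) ≡ eval k (λ j → g j xs) x) →
               Degree≤ (suc n) d f

  degree≤-cong : ∀ {n d f f′} → Degree≤ n d f → (∀ {v} → OnGrid v → f v ≡ f′ v) → Degree≤ n d f′
  degree≤-cong constant                     _  = constant
  degree≤-cong (expand g deg-g high-g f≡g) f≡f′ =
    expand g deg-g high-g (λ x∈S xs∈ → trans (sym (f≡f′ (x∈S ∷ xs∈))) (f≡g x∈S xs∈))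

  degree≤-mono : ∀ {n d d′ f} → d ≤ d′ → Degree≤ n d f → Degree≤ n d′ f
  degree≤-mono d≤d′ constant = constant
  degree≤-mono d≤d′ (expand g deg-g high-g f≡g) =
    expand g (λ {j} j<k → degree≤-mono (ℕₚ.∸-monoˡ-≤ j d≤d′) (deg-g j<k)) (λ j<k d′<j → high-g j<k (ℕₚ.≤-<-trans d≤d′ d′<j)) f≡g

  degree≤-constant : ∀ n d c → Degree≤ n d (λ _ → c)
  degree≤-constant zero    d c = constant
  degree≤-constant (suc n) d c =
    expand (λ j _ → coeff j) (λ _ → degree≤-constant n _ _) high-coeff (λ {x} _ _ → sym (c≡eval x))
    where
    coeff : ℕ → ℤ
    coeff zero    = c
    coeff (suc j) = 0ℤ
    high-coeff : ∀ {j} → j < k → d < j → Vanishes {n} (λ _ → coeff j)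
    high-coeff {suc j} _ _ _ = refl
    c≡eval : ∀ x → eval k coeff x ≡ c
    c≡eval x = begin
      c + x * eval k₁ (tail coeff) x ≡⟨ cong (λ w → c + x * w) (eval-vanishing k₁ x (λ _ → refl)) ⟩
      c + x * 0ℤ                     ≡⟨ cong (c +_) (ℤₚ.*-zeroʳ x) ⟩
      c + 0ℤ                         ≡⟨ ℤₚ.+-identityʳ c ⟩
      c                              ∎
      where open ≡-Reasoning

  degree≤-vanishing : ∀ {n d f} → Vanishes f → Degree≤ n d f
  degree≤-vanishing {n} {d} f≡0 = degree≤-cong (degree≤-constant n d 0ℤ) (λ v∈ → sym (f≡0 v∈))

  degree≤-+ : ∀ {n d f f′} → Degree≤ n d f → Degree≤ n d f′ → Degree≤ n d (λ v → f v + f′ v)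
  degree≤-+ constant constant = constant
  degree≤-+ (expand g deg-g high-g f≡g) (expand g′ deg-g′ high-g′ f′≡g′) =
    expand (λ j v → g j v + g′ j v) (λ j<k → degree≤-+ (deg-g j<k) (deg-g′ j<k))
      (λ j<k d<j v∈ → cong₂ _+_ (high-g j<k d<j v∈) (high-g′ j<k d<j v∈))
      (λ {x} {xs} x∈S xs∈ → trans (cong₂ _+_ (f≡g x∈S xs∈) (f′≡g′ x∈S xs∈)) (sym (eval-+ k (λ j → g j xs) (λ j → g′ j xs) x)))

  degree≤-*ˡ : ∀ {n d f} c → Degree≤ n d f → Degree≤ n d (λ v → c * f v)
  degree≤-*ˡ c constant = constant
  degree≤-*ˡ c (expand g deg-g high-g f≡g) =
    expand (λ j v → c * g j v) (λ j<k → degree≤-*ˡ c (deg-g j<k))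
      (λ j<k d<j v∈ → trans (cong (c *_) (high-g j<k d<j v∈)) (ℤₚ.*-zeroʳ c))
      (λ {x} {xs} x∈S xs∈ → trans (cong (c *_) (f≡g x∈S xs∈)) (sym (eval-*ˡ k c (λ j → g j xs) x)))

  degree≤-*-affine : ∀ {n d f ℓ} → Degree≤ n d f → Affine n ℓ → Degree≤ n (suc d) (λ v → f v * ℓ v)
  degree≤-*-affine constant constant = constant
  degree≤-*-affine {suc n} {d} {f} {ℓ} (expand g deg-g high-g f≡g) (expand α ℓ′ ℓ′-affine ℓ≡) =
    expand h deg-h high-h fℓ≡h
    where
    h : ℕ → Vec ℤ n → ℤ
    h j v = (g j v * ℓ′ v + α * shift (λ i → g i v) j) + α * (r j * g k₁ v)
    deg-g*ℓ′ : ∀ {j} → j < k → Degree≤ n (suc d ∸ j) (λ v → g j v * ℓ′ v)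
    deg-g*ℓ′ {j} j<k with j ≤? d
    ... | yes j≤d = subst (λ e → Degree≤ n e (λ v → g j v * ℓ′ v)) (sym (ℕₚ.+-∸-assoc 1 j≤d)) (degree≤-*-affine (deg-g j<k) ℓ′-affine)
    ... | no  j≰d = degree≤-vanishing λ v∈ → cong (ℤ._* ℓ′ _) (high-g j<k (ℕₚ.≰⇒> j≰d) v∈)
    deg-shift : ∀ {j} → j < k → Degree≤ n (suc d ∸ j) (λ v → α * shift (λ i → g i v) j)
    deg-shift {zero}  _   = degree≤-vanishing λ _ → ℤₚ.*-zeroʳ α
    deg-shift {suc j} j<k = degree≤-*ˡ α (deg-g (ℕₚ.<-trans (ℕₚ.n<1+n j) j<k))
    deg-top : ∀ {j} → j < k → Degree≤ n (suc d ∸ j) (λ v → α * (r j * g k₁ v))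
    deg-top {j} j<k = degree≤-mono (ℕₚ.≤-trans (ℕₚ.∸-monoʳ-≤ d (s≤s⁻¹ j<k)) (ℕₚ.∸-monoˡ-≤ j (ℕₚ.n≤1+n d)))
                        (degree≤-*ˡ α (degree≤-*ˡ (r j) (deg-g (ℕₚ.n<1+n k₁))))
    deg-h : ∀ {j} → j < k → Degree≤ n (suc d ∸ j) (h j)
    deg-h j<k = degree≤-+ (degree≤-+ (deg-g*ℓ′ j<k) (deg-shift j<k)) (deg-top j<k)
    high-h : ∀ {j} → j < k → suc d < j → Vanishes (h j)
    high-h {suc j} j<k d<j {v} v∈
      rewrite high-g j<k (ℕₚ.<-trans (ℕₚ.n<1+n d) d<j) v∈
            | high-g (ℕₚ.<-trans (ℕₚ.n<1+n j) j<k) (s≤s⁻¹ d<j) v∈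
            | high-g (ℕₚ.n<1+n k₁) (ℕₚ.<-trans (s≤s⁻¹ d<j) (s≤s⁻¹ j<k)) v∈ =
      solve 3 (λ l α ρ → (con 0ℤ :* l :+ α :* con 0ℤ) :+ α :* (ρ :* con 0ℤ) := con 0ℤ) refl (ℓ′ v) α (r (suc j))
      where
      open import Data.Integer.Solver using (module +-*-Solver)
      open +-*-Solver
    fℓ≡h : ∀ {x xs} → x ∈ S → OnGrid xs → f (x ∷ xs) * ℓ (x ∷ xs) ≡ eval k (λ j → h j xs) x
    fℓ≡h {x} {xs} x∈S xs∈ = trans (cong₂ _*_ (f≡g x∈S xs∈) (ℓ≡ x xs))
                              (eval-*-linear k₁ (λ j → g j xs) r α (ℓ′ xs) x (r-reduces x∈S))

  degree≤-∏ : ∀ {n} m (ℓ : Fin m → Vec ℤ n → ℤ) → (∀ i → Affine n (ℓ i)) → Degree≤ n m (λ v → ∏ m (λ i → ℓ i v))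
  degree≤-∏ {n} zero    ℓ affine = degree≤-constant n 0 1ℤ
  degree≤-∏ {n} (suc m) ℓ affine =
    degree≤-cong (degree≤-*-affine (degree≤-∏ m (λ i → ℓ (Fin.suc i)) (λ i → affine (Fin.suc i))) (affine Fin.zero))
      (λ {v} _ → ℤₚ.*-comm (∏ m (λ i → ℓ (Fin.suc i) v)) (ℓ Fin.zero v))

  nonzeros : ∀ n → (Vec ℤ n → ℤ) → ℕ
  nonzeros n f = ∑ (allMaps S n) (λ v → nonzero (f v))

  nonzeros-pos⇒¬vanishes : ∀ {n f} → 0 < nonzeros n f → ¬ Vanishes f
  nonzeros-pos⇒¬vanishes {n} {f} pos f≡0 = ℕₚ.<-irrefl (sym N≡0) pos
    where
    N≡0 : nonzeros n f ≡ 0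
    N≡0 = trans (∑-cong (allMaps S n) (λ v∈ → cong nonzero (f≡0 (allMaps-sound v∈)))) (∑-zero (allMaps S n))

  ¬nonzeros-pos⇒vanishes : ∀ {n f} → ¬ 0 < nonzeros n f → Vanishes f
  ¬nonzeros-pos⇒vanishes {n} {f} ¬pos {v} v∈ =
    nonzero≡0⇒≡0 (f v) (∑≡0⇒≡0 (allMaps S n) (ℕₚ.n≤0⇒n≡0 (ℕₚ.≮⇒≥ ¬pos)) (allMaps-complete v∈))

  -- If g t xs ≠ 0, then x ↦ f (x ∷ xs) is a polynomial of degree t on S, so it has at most t
  -- roots among the k points of S.
  nonzeros-suc : ∀ {n f} (g : ℕ → Vec ℤ n → ℤ) → (∀ {x xs} → x ∈ S → OnGrid xs → f (x ∷ xs) ≡ eval k (λ j → g j xs) x) →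
    ∀ {t} → t < k → (∀ {j} → t < j → j < k → Vanishes (g j)) →
    (k ∸ t) ℕ.* nonzeros n (g t) ≤ nonzeros (suc n) f
  nonzeros-suc {n} {f} g f≡g {t} t<k high = begin
    (k ∸ t) ℕ.* ∑ (allMaps S n) (λ xs → nonzero (g t xs))   ≡⟨ ∑-*ˡ (allMaps S n) (k ∸ t) _ ⟨
    ∑ (allMaps S n) (λ xs → (k ∸ t) ℕ.* nonzero (g t xs))   ≤⟨ ∑-mono (allMaps S n) (λ xs∈ → pointwise (allMaps-sound xs∈)) ⟩
    ∑ (allMaps S n) (λ xs → ∑ S (λ x → nonzero (f (x ∷ xs)))) ≡⟨ ∑-allMaps-suc n (λ v → nonzero (f v)) ⟨
    nonzeros (suc n) f                                     ∎
    where
    open ℕₚ.≤-Reasoning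
    pointwise : ∀ {xs} → OnGrid xs → (k ∸ t) ℕ.* nonzero (g t xs) ≤ ∑ S (λ x → nonzero (f (x ∷ xs)))
    pointwise {xs} xs∈ with g t xs ℤₚ.≟ 0ℤ
    ... | yes gt≡0 = ℕₚ.≤-trans (ℕₚ.≤-reflexive (trans (cong (λ z → (k ∸ t) ℕ.* nonzero z) gt≡0) (ℕₚ.*-zeroʳ (k ∸ t)))) z≤n
    ... | no  gt≢0 = begin
      (k ∸ t) ℕ.* nonzero (g t xs)               ≡⟨ cong ((k ∸ t) ℕ.*_) (nonzero-≢0 gt≢0) ⟩
      (k ∸ t) ℕ.* 1                              ≡⟨ ℕₚ.*-identityʳ (k ∸ t) ⟩
      k ∸ t                                      ≤⟨ ℕₚ.m≤n+o⇒m∸n≤o k t k≤t+nonroots ⟩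
      nonroots S (eval (suc t) (λ j → g j xs))     ≡⟨ same-nonroots ⟨
      ∑ S (λ x → nonzero (f (x ∷ xs)))             ∎
      where
      same-nonroots : ∑ S (λ x → nonzero (f (x ∷ xs))) ≡ nonroots S (eval (suc t) (λ j → g j xs))
      same-nonroots = ∑-cong S λ {x} x∈S → cong nonzero
        (trans (f≡g x∈S xs∈) (eval-shrink k t (λ j → g j xs) x t<k (λ t<j j<k → high t<j j<k xs∈)))
      k≤t+nonroots : k ≤ t ℕ.+ nonroots S (eval (suc t) (λ j → g j xs))
      k≤t+nonroots = subst₂ _≤_ |S|≡k (ℕₚ.+-comm _ t) (length≤nonroots+degree S-distinct t (λ j → g j xs) gt≢0)

  alon-füredi : ∀ {n d f} → Degree≤ n d f → 0 < nonzeros n f → k ^ (k₁ ℕ.* n ∸ d) ≤ nonzeros n f ^ k₁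
  alon-füredi {zero} {d} {f} constant pos rewrite ℕₚ.*-zeroʳ k₁ | ℕₚ.0∸n≡0 d =
    ℕₚ.m^n>0 (nonzeros 0 f) {{ℕ.>-nonZero pos}} k₁
  alon-füredi {suc n} {d} {f} (expand g deg-g high-g f≡g) pos
    with largest? (λ j → 0 <? nonzeros n (g j)) k
  ... | inj₁ none = ⊥-elim (nonzeros-pos⇒¬vanishes pos f≡0)
    where
    f≡0 : Vanishes f
    f≡0 {x ∷ _} (x∈S ∷ xs∈) = trans (f≡g x∈S xs∈) (eval-vanishing k x (λ j<k → ¬nonzeros-pos⇒vanishes (none j<k) xs∈))
  ... | inj₂ (t , t<k , gt-pos , above) =
    alon-füredi-step k₁ n d t _ _ t≤d (s≤s⁻¹ t<k) (alon-füredi (deg-g t<k) gt-pos)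
      (nonzeros-suc g f≡g t<k (λ t<j j<k → ¬nonzeros-pos⇒vanishes (above t<j j<k)))
    where
    t≤d : t ≤ d
    t≤d with t ≤? d
    ... | yes t≤d = t≤d
    ... | no  t≰d = ⊥-elim (nonzeros-pos⇒¬vanishes gt-pos (high-g t<k (ℕₚ.≰⇒> t≰d)))

module ColouringPolynomial where
  open import Data.Integer using (_+_; _*_; _-_; -_)

  affine-constant : ∀ n c → Affine n (λ _ → c)
  affine-constant zero    c = constant
  affine-constant (suc n) c = expand 0ℤ (λ _ → c) (affine-constant n c) (λ _ _ → sym (ℤₚ.+-identityˡ c))

  affine-lookup : ∀ n (i : Fin n) → Affine n (λ v → lookup v i)
  affine-lookup (suc n) Fin.zero =
    expand ℤ.1ℤ (λ _ → 0ℤ) (affine-constant n 0ℤ) (λ x _ → sym (trans (ℤₚ.+-identityʳ (ℤ.1ℤ * x)) (ℤₚ.*-identityˡ x)))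
  affine-lookup (suc n) (Fin.suc i) =
    expand 0ℤ (λ xs → lookup xs i) (affine-lookup n i) (λ _ xs → sym (ℤₚ.+-identityˡ (lookup xs i)))

  affine-+ : ∀ {n a b} → Affine n a → Affine n b → Affine n (λ v → a v + b v)
  affine-+ constant constant = constant
  affine-+ (expand α a′ a′-affine a≡) (expand β b′ b′-affine b≡) =
    expand (α + β) (λ xs → a′ xs + b′ xs) (affine-+ a′-affine b′-affine)
      (λ x xs → trans (cong₂ _+_ (a≡ x xs) (b≡ x xs)) (shuffle α β x (a′ xs) (b′ xs)))
    where
    shuffle : ∀ α β x p q → (α * x + p) + (β * x + q) ≡ (α + β) * x + (p + q)
    shuffle = solve-∀
      where open import Data.Integer.Tactic.RingSolver using (solve-∀)

  affine-neg : ∀ {n a} → Affine n a → Affine n (λ v → - a v)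
  affine-neg constant = constant
  affine-neg (expand α a′ a′-affine a≡) =
    expand (- α) (λ xs → - a′ xs) (affine-neg a′-affine)
      (λ x xs → trans (cong -_ (a≡ x xs)) (trans (ℤₚ.neg-distrib-+ (α * x) (a′ xs)) (cong (_+ - a′ xs) (ℤₚ.neg-distribˡ-* α x))))

  affine-applySign : ∀ {n a} s → Affine n a → Affine n (λ v → applySign s (a v))
  affine-applySign Sign.+ a-affine = a-affine
  affine-applySign Sign.- a-affine = affine-neg a-affine

  edge-form : ∀ {n} (G : Graph n) → Signature G → Fin (m G) → Vec ℤ n → ℤ
  edge-form G ε e κ = lookup κ (proj₂ (edge G e)) - applySign (ε e) (lookup κ (proj₁ (edge G e)))

  colouring-polynomial : ∀ {n} (G : Graph n) → Signature G → Vec ℤ n → ℤ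
  colouring-polynomial G ε κ = ∏ (m G) (λ e → edge-form G ε e κ)

  affine-edge-form : ∀ {n} (G : Graph n) ε e → Affine n (edge-form G ε e)
  affine-edge-form {n} G ε e =
    affine-+ (affine-lookup n (proj₂ (edge G e))) (affine-neg (affine-applySign (ε e) (affine-lookup n (proj₁ (edge G e)))))

  ∏≡0 : ∀ m h i → h i ≡ 0ℤ → ∏ m h ≡ 0ℤ
  ∏≡0 (suc m) h Fin.zero    hi≡0 = cong (_* ∏ m (λ i → h (Fin.suc i))) hi≡0
  ∏≡0 (suc m) h (Fin.suc i) hi≡0 = trans (cong (h Fin.zero *_) (∏≡0 m (λ i → h (Fin.suc i)) i hi≡0)) (ℤₚ.*-zeroʳ (h Fin.zero))

  ∏≢0 : ∀ m h → (∀ i → h i ≢ 0ℤ) → ∏ m h ≢ 0ℤ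
  ∏≢0 zero    h h≢0 ()
  ∏≢0 (suc m) h h≢0 ∏≡0′ with ℤₚ.i*j≡0⇒i≡0∨j≡0 (h Fin.zero) ∏≡0′
  ... | inj₁ h0≡0 = h≢0 Fin.zero h0≡0
  ... | inj₂ rest = ∏≢0 m (λ i → h (Fin.suc i)) (h≢0 ∘ Fin.suc) rest

  colouring⇒polynomial≢0 : ∀ {n} (G : Graph n) ε κ → IsColoring G ε κ → colouring-polynomial G ε κ ≢ 0ℤ
  colouring⇒polynomial≢0 G ε κ κ-col = ∏≢0 (m G) _ (λ e → κ-col e ∘ ℤₚ.i-j≡0⇒i≡j _ _)

  polynomial≢0⇒colouring : ∀ {n} (G : Graph n) ε κ → colouring-polynomial G ε κ ≢ 0ℤ → IsColoring G ε κ
  polynomial≢0⇒colouring G ε κ p≢0 e = p≢0 ∘ ∏≡0 (m G) _ e ∘ ℤₚ.i≡j⇒i-j≡0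

open import Data.Nat using (_+_; _*_; _∸_; _^_; _≥_)
open import Data.Nat.Primality using (Prime)

∣∣<⇒≢ : ∀ {x y} → ∣ x ∣ < ∣ y ∣ → x ≢ y
∣∣<⇒≢ ∣x∣<∣y∣ refl = ℕₚ.<-irrefl refl ∣x∣<∣y∣

∣applySign∣ : ∀ s y → ∣ applySign s y ∣ ≡ ∣ y ∣
∣applySign∣ Sign.+ y = refl
∣applySign∣ Sign.- y = ℤₚ.∣-i∣≡∣i∣ y

applySign-0 : ∀ s → applySign s 0ℤ ≡ 0ℤ
applySign-0 Sign.+ = refl
applySign-0 Sign.- = refl

M-length : ∀ k → length (M k) ≡ k
M-length zero          = refl
M-length (suc zero)    = refl
M-length (suc (suc k)) = trans (Listₚ.length-++ (M k)) (trans (cong (_+ 2) (M-length k)) (ℕₚ.+-comm k 2))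

M-bounded : ∀ k {y} → y ∈ M k → ∣ y ∣ ≤ ⌊ k /2⌋
M-bounded (suc zero)    (here refl) = z≤n
M-bounded (suc (suc k)) y∈ with ∈-++⁻ (M k) y∈
... | inj₁ y∈M                = ℕₚ.m≤n⇒m≤1+n (M-bounded k y∈M)
... | inj₂ (here refl)        = ℕₚ.≤-refl
... | inj₂ (there (here refl)) = ℕₚ.≤-refl

M-complete : ∀ k {y} → y ≢ 0ℤ → ∣ y ∣ ≤ ⌊ k /2⌋ → y ∈ M k
M-complete k {ℤ.+ zero} y≢0 _ = ⊥-elim (y≢0 refl)
M-complete zero          {+[1+ _ ]} _ ()
M-complete zero          { -[1+ _ ]} _ ()
M-complete (suc zero)    {+[1+ _ ]} _ ()
M-complete (suc zero)    { -[1+ _ ]} _ ()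
M-complete (suc (suc k)) {y} y≢0 y≤ with ℕₚ.m≤n⇒m<n∨m≡n y≤
... | inj₁ y<      = ∈-++⁺ˡ (M-complete k y≢0 (s≤s⁻¹ y<))
M-complete (suc (suc k)) {+[1+ _ ]} _ _ | inj₂ refl = ∈-++⁺ʳ (M k) (here refl)
M-complete (suc (suc k)) { -[1+ _ ]} _ _ | inj₂ refl = ∈-++⁺ʳ (M k) (there (here refl))

M-distinct : ∀ k → Distinct (M k)
M-distinct zero          = []
M-distinct (suc zero)    = [] ∷ []
M-distinct (suc (suc k)) =
  AllPairsₚ.++⁺ (M-distinct k) (((λ ()) ∷ []) ∷ [] ∷ []) (Allₗ.tabulate λ y∈ → below y∈ refl ∷ below y∈ (ℤₚ.∣-i∣≡∣i∣ +[1+ ⌊ k /2⌋ ]) ∷ [])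
  where
  below : ∀ {y z} → y ∈ M k → ∣ z ∣ ≡ suc ⌊ k /2⌋ → y ≢ z
  below y∈ ∣z∣≡ = ∣∣<⇒≢ (subst (_ <_) (sym ∣z∣≡) (s≤s (M-bounded k y∈)))

0∈M-shrink : ∀ k → 0ℤ ∈ M (suc (suc k)) → 0ℤ ∈ M k
0∈M-shrink k 0∈ with ∈-++⁻ (M k) 0∈
... | inj₁ 0∈M = 0∈M
... | inj₂ (here ())
... | inj₂ (there (here ()))
... | inj₂ (there (there ()))

0∈M-lost : ∀ {k′ k} → k′ ≤ k → 0ℤ ∈ M k′ → 0ℤ ∉ M k → ⌊ k′ /2⌋ < ⌊ k /2⌋
0∈M-lost {suc zero}    {suc zero}    _ _ 0∉ = ⊥-elim (0∉ (here refl))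
0∈M-lost {suc zero}    {suc (suc k)} _ _ _  = s≤s z≤n
0∈M-lost {suc (suc k′)} {suc (suc k)} (s≤s (s≤s k′≤k)) 0∈ 0∉ =
  s≤s (0∈M-lost k′≤k (0∈M-shrink k′ 0∈) (0∉ ∘ ∈-++⁺ˡ))

replace-zero : ℤ → ℤ → ℤ
replace-zero c (ℤ.+ zero) = c
replace-zero c +[1+ y ]   = +[1+ y ]
replace-zero c -[1+ y ]   = -[1+ y ]

replace-zero-≢0 : ∀ c {y} → y ≢ 0ℤ → replace-zero c y ≡ y
replace-zero-≢0 c {ℤ.+ zero} y≢0 = ⊥-elim (y≢0 refl)
replace-zero-≢0 c {+[1+ _ ]} _   = refl
replace-zero-≢0 c { -[1+ _ ]} _  = refl

replace-zero-respects : ∀ s {c a b} → ∣ a ∣ < ∣ c ∣ → ∣ b ∣ < ∣ c ∣ →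
  a ≢ applySign s b → replace-zero c a ≢ applySign s (replace-zero c b)
replace-zero-respects s {c} {a} {b} a< b< a≢sb with a ℤₚ.≟ 0ℤ | b ℤₚ.≟ 0ℤ
... | yes refl | yes refl = ⊥-elim (a≢sb (sym (applySign-0 s)))
... | yes refl | no b≢0 rewrite replace-zero-≢0 c b≢0 =
  ∣∣<⇒≢ (subst (_< ∣ c ∣) (sym (∣applySign∣ s b)) b<) ∘ sym
... | no a≢0 | yes refl rewrite replace-zero-≢0 c a≢0 =
  ∣∣<⇒≢ (subst (∣ a ∣ <_) (sym (∣applySign∣ s c)) a<)
... | no a≢0 | no b≢0 rewrite replace-zero-≢0 c a≢0 | replace-zero-≢0 c b≢0 = a≢sb

Colouring : ∀ {n} (G : Graph n) → Signature G → ℕ → Set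
Colouring {n} G ε k = Σ (Vec ℤ n) λ κ → AllV (_∈ M k) κ × IsColoring G ε κ

-- M k′ ⊆ M k unless 0 ∈ M k′ and 0 ∉ M k; then 0 is recoloured by a colour of larger modulus.
colouring-mono : ∀ {n} (G : Graph n) ε {k′ k} → k′ ≤ k → Colouring G ε k′ → Colouring G ε k
colouring-mono G ε {k′} {k} k′≤k (κ , κ∈ , κ-col) with 0ℤ ∈? M k
... | yes 0∈ = κ , Allᵥ.map into κ∈ , κ-col
  where
  into : ∀ {y} → y ∈ M k′ → y ∈ M k
  into {y} y∈ with y ℤₚ.≟ 0ℤ
  ... | yes refl = 0∈
  ... | no  y≢0  = M-complete k y≢0 (ℕₚ.≤-trans (M-bounded k′ y∈) (ℕₚ.⌊n/2⌋-mono k′≤k))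
... | no 0∉ = Vec.map φ κ , Allᵥₚ.gmap into κ∈ , φκ-col
  where
  c : ℤ
  c = +[1+ ⌊ k′ /2⌋ ]
  φ : ℤ → ℤ
  φ = replace-zero c
  into : ∀ {y} → y ∈ M k′ → φ y ∈ M k
  into {y} y∈ with y ℤₚ.≟ 0ℤ
  ... | yes refl = M-complete k (λ ()) (0∈M-lost k′≤k y∈ 0∉)
  ... | no  y≢0  rewrite replace-zero-≢0 c y≢0 =
    M-complete k y≢0 (ℕₚ.≤-trans (M-bounded k′ y∈) (ℕₚ.⌊n/2⌋-mono k′≤k))
  small : ∀ i → ∣ lookup κ i ∣ < ∣ c ∣
  small i = s≤s (M-bounded k′ (Allᵥ.lookup κ∈ (∈-lookup i κ)))
  φκ-col : IsColoring G ε (Vec.map φ κ)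
  φκ-col e rewrite Vecₚ.lookup-map (proj₂ (edge G e)) φ κ | Vecₚ.lookup-map (proj₁ (edge G e)) φ κ =
    replace-zero-respects (ε e) (small (proj₂ (edge G e))) (small (proj₁ (edge G e))) (κ-col e)

open FiniteSums
open ColouringPolynomial

length-filter≡∑nonzero : ∀ {A : Set} {P : A → Set} (P? : Decidable P) (w : A → ℤ) →
  (∀ {a} → P a → w a ≢ 0ℤ) → (∀ {a} → w a ≢ 0ℤ → P a) →
  ∀ L → length (filter P? L) ≡ ∑ L (λ a → nonzero (w a))
length-filter≡∑nonzero P? w P⇒≢0 ≢0⇒P []      = refl
length-filter≡∑nonzero P? w P⇒≢0 ≢0⇒P (a ∷ L) with P? a
... | yes Pa  rewrite nonzero-≢0 (P⇒≢0 Pa)   = cong suc (length-filter≡∑nonzero P? w P⇒≢0 ≢0⇒P L)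
... | no  ¬Pa rewrite nonzero-¬≢0 (¬Pa ∘ ≢0⇒P) = length-filter≡∑nonzero P? w P⇒≢0 ≢0⇒P L

filter-witness : ∀ {A : Set} {P : A → Set} (P? : Decidable P) L → 0 < length (filter P? L) → ∃ λ a → a ∈ L × P a
filter-witness P? L pos with filter P? L | (λ {v} → ∈-filter⁻ P? {v} {L})
... | a ∷ _ | ∈⇒ = a , ∈⇒ (here refl)

P-bound : ∀ {n} (G : Graph n) k₁ ε → χ≤ G ε (suc k₁) → suc k₁ ^ (k₁ * n ∸ m G) ≤ P G ε (suc k₁) ^ k₁
P-bound {n} G k₁ ε (k′ , k′≤k , P′-pos) =
  subst (λ N → _ ≤ N ^ k₁) (sym P≡nonzeros) (alon-füredi (degree≤-∏ (m G) (edge-form G ε) (affine-edge-form G ε)) pos)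
  where
  open AlonFüredi k₁ (M (suc k₁)) (M-distinct (suc k₁)) (M-length (suc k₁))
  open Grid
  P≡nonzeros : P G ε k ≡ nonzeros n (colouring-polynomial G ε)
  P≡nonzeros = length-filter≡∑nonzero (isColoring? G ε) (colouring-polynomial G ε)
                 (λ {κ} → colouring⇒polynomial≢0 G ε κ) (λ {κ} → polynomial≢0⇒colouring G ε κ) (allMaps (M k) n)
  κ-col : Colouring G ε k
  κ-col with filter-witness (isColoring? G ε) (allMaps (M k′) n) P′-pos
  ... | κ′ , κ′∈ , κ′-col = colouring-mono G ε k′≤k (κ′ , allMaps-sound (M k′) κ′∈ , κ′-col)
  pos : 0 < nonzeros n (colouring-polynomial G ε)
  pos with κ-col
  ... | κ , κ∈ , col = ∑-pos (allMaps (M k) n) (allMaps-complete (M k) κ∈)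
                         (ℕₚ.≤-reflexive (sym (nonzero-≢0 (colouring⇒polynomial≢0 G ε κ col))))

minimum-∈ : ∀ {y xs} → y ∈ xs → minimum xs ∈ xs
minimum-∈ {xs = x ∷ xs} _ = foldr-⊓-∈ x xs
  where
  foldr-⊓-∈ : ∀ x xs → foldr _⊓_ x xs ∈ x ∷ xs
  foldr-⊓-∈ x []       = here refl
  foldr-⊓-∈ x (y ∷ ys) with ℕₚ.⊓-sel y (foldr _⊓_ x ys)
  ... | inj₁ ≡y = subst (_∈ x ∷ y ∷ ys) (sym ≡y) (there (here refl))
  ... | inj₂ ≡r = subst (_∈ x ∷ y ∷ ys) (sym ≡r) (widen (foldr-⊓-∈ x ys))
    where
    widen : ∀ {z} → z ∈ x ∷ ys → z ∈ x ∷ y ∷ ys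
    widen (here z≡x) = here z≡x
    widen (there z∈) = there (there z∈)

P±-bound : ∀ {n} (G : Graph n) k₁ → χ±≤ G (suc k₁) → suc k₁ ^ (k₁ * n ∸ m G) ≤ P± G (suc k₁) ^ k₁
P±-bound G k₁ χ with ∈-map⁻ (λ ε → P G ε (suc k₁)) (minimum-∈ (∈-map⁺ (λ ε → P G ε (suc k₁)) some-signature))
  where
  some-signature : lookup (Vec.replicate (m G) Sign.+) ∈ allSignatures G
  some-signature = ∈-map⁺ lookup (Grid.allMaps-complete _ (Allᵥ.universal every-sign (Vec.replicate (m G) Sign.+)))
    where
    every-sign : ∀ s → s ∈ Sign.+ ∷ Sign.- ∷ []
    every-sign Sign.+ = here refl
    every-sign Sign.- = there (here refl)
... | ε , _ , P±≡P = subst (λ N → _ ≤ N ^ k₁) (sym P±≡P) (P-bound G k₁ ε (χ ε))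

-- Over ℤ the argument works for every k.
corollary1p5 : (n : ℕ) (G : Graph n) (k : ℕ) →
    (∃₂ λ p r → Prime p × 1 ≤ r × k ≡ p ^ r) →
    χ±≤ G k →
    m G ≤ (k ∸ 1) * n →
    P± G k ^ (k ∸ 1) ≥ k ^ ((k ∸ 1) * n ∸ m G)
corollary1p5 n G zero    _ _ _ rewrite ℕₚ.0∸n≡0 (m G) = ℕₚ.≤-refl
corollary1p5 n G (suc k₁) _ χ _ = P±-bound G k₁ χ
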